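{- Let $S$ be a reflective numerical semigroup of genus $g(S)=g\ge1$ and multiplicity $m(S)=a$. Then the embedding dimension of $S$ is \[ e(S)=\begin{cases} a-1 & \text{if } g\not\equiv -1\pmod a,\\ a & \text{if } g\equiv -1\pmod a.\end{cases} \]
   Context: A numerical semigroup is a submonoid $S$ of $(\mathbb{N}_0,+)$ with finite complement; $g(S)=\#(\mathbb{N}_0\setminus S)$, $m(S)$ is the smallest positive element of $S$, and the embedding dimension $e(S)$ is the cardinality of the unique minimal generating set of $S$ (a set $A$ with $S$ equal to the set of finite $\mathbb{N}_0$-linear combinations of $A$, no element of which is such a combination of the others). $S$ (with $g=g(S)\ge1$) is reflective if for every integer $z$ with $0\le z\le g-1$ exactly one of $z$ and $z+g$ lies in $S$. -}

module Defs where

open import Data.Bool using (Bool; true; false)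
open import Data.Nat using (ℕ; zero; suc; _+_; _*_; _≤_; _<_)
open import Data.List using (List; []; _∷_; length; lookup; removeAt)
open import Data.List.Relation.Unary.Unique.Propositional using (Unique)
open import Data.Product using (Σ; _×_; ∃-syntax; _,_)
open import Data.Sum using (_⊎_)
open import Relation.Binary.PropositionalEquality using (_≡_; _≢_)
open import Relation.Nullary using (¬_)
open import Function.Bundles using (_⇔_)

record NumericalSemigroup : Set where
  field
    mem      : ℕ → Bool
    zero∈    : mem 0 ≡ true
    closed   : ∀ x y → mem x ≡ true → mem y ≡ true → mem (x + y) ≡ true
    bound    : ℕ
    cofinite : ∀ n → bound ≤ n → mem n ≡ true

open NumericalSemigroup public

_∈S_ : ℕ → NumericalSemigroup → Set
x ∈S S = mem S x ≡ true

_∉S_ : ℕ → NumericalSemigroup → Set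
x ∉S S = mem S x ≡ false

gapsBelow : NumericalSemigroup → ℕ → ℕ
gapsBelow S zero = 0
gapsBelow S (suc N) with mem S N
... | true  = gapsBelow S N
... | false = suc (gapsBelow S N)

-- genus g(S) = #(ℕ \ S); all gaps lie below `bound S`.
genus : NumericalSemigroup → ℕ
genus S = gapsBelow S (bound S)

IsMultiplicity : NumericalSemigroup → ℕ → Set
IsMultiplicity S a = 0 < a × a ∈S S × (∀ b → 0 < b → b < a → b ∉S S)

IsComb : List ℕ → ℕ → Set
IsComb []       n = n ≡ 0
IsComb (a ∷ as) n = ∃[ k ] ∃[ m ] (n ≡ k * a + m × IsComb as m)

IsMinimalGeneratingSet : NumericalSemigroup → List ℕ → Set
IsMinimalGeneratingSet S A =
  Unique A ×
  (∀ n → (n ∈S S) ⇔ IsComb A n) ×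
  (∀ i → ¬ IsComb (removeAt A i) (lookup A i))

-- S is reflective (with g = genus S ≥ 1 assumed separately)
IsReflective : NumericalSemigroup → Set
IsReflective S = ∀ z → z < genus S →
  (z ∈S S × (z + genus S) ∉S S) ⊎ (z ∉S S × (z + genus S) ∈S S)

{-# OPTIONS --safe #-}
module Submission where

-- Reflection pairs each z < g with g + z, so exactly g of the numbers below 2g are
-- gaps and every n ≥ 2g lies in S.  If x ∈ S with a ≤ x < g, then x − a ∈ S, for
-- otherwise g + (x − a) and hence g + x would lie in S; so S ∩ [0, g) consists of
-- multiples of a.  Consequently the atoms of S are a, the numbers g + t with
-- 0 < t < a other than the unique t = s with a ∣ g + s, and 2g + 1 when s = 1, that
-- is when a ∣ g + 1.  A minimal generating set consists exactly of the atoms.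

open import Defs
open import Data.Bool using (true; false)
open import Data.Empty using (⊥-elim)
open import Data.Fin using (zero; suc)
open import Data.List using (List; []; _∷_; _++_; [_]; length; lookup; removeAt; applyUpTo)
open import Data.List.Properties using (length-++; length-applyUpTo)
open import Data.List.Membership.Propositional using (_∈_; _∉_)
open import Data.List.Membership.Propositional.Properties
  using (∈-lookup; ∈-++⁺ˡ; ∈-++⁺ʳ; ∈-++⁻; ∈-applyUpTo⁺; ∈-applyUpTo⁻)
open import Data.List.Membership.Propositional.Properties.WithK using (unique∧set⇒bag)
open import Data.List.Relation.Binary.BagAndSetEquality using (∼bag⇒↭)
open import Data.List.Relation.Binary.Permutation.Propositional.Properties using (↭-length)
import Data.List.Relation.Unary.All as All
open import Data.List.Relation.Unary.AllPairs as AllPairs using (AllPairs; []; _∷_)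
import Data.List.Relation.Unary.AllPairs.Properties as AllPairsₚ
open import Data.List.Relation.Unary.Any using (here; there; index)
open import Data.List.Relation.Unary.Any.Properties using (lookup-index)
open import Data.List.Relation.Unary.Unique.Propositional using (Unique)
open import Data.Nat
open import Data.Nat.Divisibility
  using (_∣_; divides; ∣-refl; _∣0; ∣m∣n⇒∣m+n; ∣m+n∣m⇒∣n; ∣⇒≤; >⇒∤; m%n≡0⇒n∣m)
open import Data.Nat.DivMod using (_%_; _/_; m≡m%n+[m/n]*n; m%n<n)
open import Data.Nat.Induction using (<-rec)
open import Data.Nat.Properties
open import Data.Nat.Solver using (module +-*-Solver)
open import Data.Product using (_×_; _,_; proj₁; proj₂; ∃-syntax)
open import Data.Sum as Sum using (_⊎_; inj₁; inj₂)
open import Function.Base using (_∘_)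
open import Function.Bundles using (_⇔_; mk⇔; Equivalence)
open import Relation.Binary.Definitions using (tri<; tri≈; tri>)
open import Relation.Binary.PropositionalEquality
  using (_≡_; _≢_; refl; sym; trans; cong; cong₂; subst; module ≡-Reasoning)
open import Relation.Nullary using (¬_; yes; no)
open import Algebra.Properties.CommutativeSemigroup +-commutativeSemigroup using (x∙yz≈y∙xz)
open +-*-Solver using (solve; _:+_; _:*_; _:=_; con)

∈-removeAt⁻ : ∀ {X : Set} (A : List X) i {x} → x ∈ removeAt A i → x ∈ A
∈-removeAt⁻ (_ ∷ _) zero    p           = there p
∈-removeAt⁻ (_ ∷ _) (suc i) (here refl) = here refl
∈-removeAt⁻ (_ ∷ A) (suc i) (there p)   = there (∈-removeAt⁻ A i p)

lookup∉removeAt : ∀ {X : Set} {A : List X} → Unique A → ∀ i → lookup A i ∉ removeAt A i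
lookup∉removeAt (x∉A ∷ _) zero    p         = All.lookup x∉A p refl
lookup∉removeAt (x∉A ∷ _) (suc i) (here eq) = All.lookup x∉A (∈-lookup i) (sym eq)
lookup∉removeAt (_ ∷ u)   (suc i) (there p) = lookup∉removeAt u i p

++-sorted : ∀ {xs ys c} → AllPairs _<_ xs → AllPairs _<_ ys →
            (∀ {x} → x ∈ xs → x < c) → (∀ {y} → y ∈ ys → c ≤ y) → AllPairs _<_ (xs ++ ys)
++-sorted sorted-xs sorted-ys xs<c c≤ys = AllPairsₚ.++⁺ sorted-xs sorted-ys
  (All.tabulate λ x∈ → All.tabulate λ y∈ → <-≤-trans (xs<c x∈) (c≤ys y∈))

interval : ℕ → ℕ → List ℕ
interval b e = applyUpTo (b +_) (e ∸ b)

∈-interval⁻ : ∀ {b e x} → x ∈ interval b e → b ≤ x × x < e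
∈-interval⁻ {b} {e} p with ∈-applyUpTo⁻ (b +_) p
... | i , i<e∸b , refl = m≤m+n b i , subst (b + i <_) (m+[n∸m]≡n b≤e) (+-monoʳ-< b i<e∸b)
  where
  b≤e : b ≤ e
  b≤e = <⇒≤ (m∸n≢0⇒n<m λ e∸b≡0 → n≮0 (subst (i <_) e∸b≡0 i<e∸b))

∈-interval⁺ : ∀ {b e x} → b ≤ x → x < e → x ∈ interval b e
∈-interval⁺ {b} b≤x x<e =
  subst (_∈ _) (m+[n∸m]≡n b≤x) (∈-applyUpTo⁺ (b +_) (∸-monoˡ-< x<e b≤x))

interval-sorted : ∀ b e → AllPairs _<_ (interval b e)
interval-sorted b e = AllPairsₚ.applyUpTo⁺₁ (b +_) (e ∸ b) λ i<j _ → +-monoʳ-< b i<j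

punctured : ℕ → ℕ → ℕ → List ℕ
punctured b m e = interval b m ++ interval (suc m) e

module _ {b m e} (b≤m : b ≤ m) (m<e : m < e) where

  ∈-punctured⁻ : ∀ {x} → x ∈ punctured b m e → b ≤ x × x < e × x ≢ m
  ∈-punctured⁻ p with ∈-++⁻ (interval b m) p
  ... | inj₁ q = let b≤x , x<m = ∈-interval⁻ q in b≤x , <-trans x<m m<e , <⇒≢ x<m
  ... | inj₂ q = let m<x , x<e = ∈-interval⁻ q in ≤-trans b≤m (<⇒≤ m<x) , x<e , >⇒≢ m<x

  ∈-punctured⁺ : ∀ {x} → b ≤ x → x < e → x ≢ m → x ∈ punctured b m e
  ∈-punctured⁺ {x} b≤x x<e x≢m with x <? m
  ... | yes x<m = ∈-++⁺ˡ (∈-interval⁺ b≤x x<m)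
  ... | no  x≮m = ∈-++⁺ʳ (interval b m) (∈-interval⁺ (≤∧≢⇒< (≮⇒≥ x≮m) (x≢m ∘ sym)) x<e)

  punctured-sorted : AllPairs _<_ (punctured b m e)
  punctured-sorted = ++-sorted (interval-sorted b m) (interval-sorted (suc m) e)
    (λ p → proj₂ (∈-interval⁻ p)) (λ p → <⇒≤ (proj₁ (∈-interval⁻ {suc m} {e} p)))

  length-punctured : suc (length (punctured b m e)) ≡ e ∸ b
  length-punctured = begin
    suc (length (punctured b m e))          ≡⟨ cong suc (length-++ (interval b m)) ⟩
    suc (length (interval b m) + length (interval (suc m) e))
      ≡⟨ cong₂ (λ k l → suc (k + l)) (length-applyUpTo _ (m ∸ b)) (length-applyUpTo _ (e ∸ suc m)) ⟩
    suc ((m ∸ b) + (e ∸ suc m))             ≡⟨ +-suc (m ∸ b) _ ⟨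
    (m ∸ b) + suc (e ∸ suc m)               ≡⟨ cong ((m ∸ b) +_) (+-∸-assoc 1 m<e) ⟨
    (m ∸ b) + (e ∸ m)                       ≡⟨ +-comm (m ∸ b) _ ⟩
    (e ∸ m) + (m ∸ b)                       ≡⟨ +-∸-assoc (e ∸ m) b≤m ⟨
    (e ∸ m + m) ∸ b                         ≡⟨ cong (_∸ b) (m∸n+n≡m (<⇒≤ m<e)) ⟩
    e ∸ b                                   ∎
    where open ≡-Reasoning

IsComb-0 : ∀ A → IsComb A 0
IsComb-0 []      = refl
IsComb-0 (_ ∷ A) = 0 , 0 , refl , IsComb-0 A

IsComb-+ : ∀ A {m n} → IsComb A m → IsComb A n → IsComb A (m + n)
IsComb-+ []      refl refl = refl
IsComb-+ (x ∷ A) (k , m , refl , cm) (l , n , refl , cn) =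
  k + l , m + n , regroup , IsComb-+ A cm cn
  where
  regroup : k * x + m + (l * x + n) ≡ (k + l) * x + (m + n)
  regroup = solve 5 (λ k l x m n → k :* x :+ m :+ (l :* x :+ n) := (k :+ l) :* x :+ (m :+ n))
                    refl k l x m n

∈⇒IsComb : ∀ {A x} → x ∈ A → IsComb A x
∈⇒IsComb {x ∷ A} (here refl) = 1 , 0 , sym (trans (+-identityʳ _) (*-identityˡ x)) , IsComb-0 A
∈⇒IsComb {_ ∷ A} {x} (there p) = 0 , x , refl , ∈⇒IsComb p

IsComb-removeAt : ∀ A i {n} → IsComb A n → n < lookup A i → IsComb (removeAt A i) n
IsComb-removeAt (x ∷ A) zero    (zero  , m , refl , c) _   = c
IsComb-removeAt (x ∷ A) zero    (suc k , m , refl , c) n<x =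
  ⊥-elim (<⇒≱ n<x (≤-trans (m≤m+n x (k * x)) (m≤m+n _ m)))
IsComb-removeAt (x ∷ A) (suc i) (k , m , refl , c) n<y =
  k , m , refl , IsComb-removeAt A i c (≤-<-trans (m≤n+m m (k * x)) n<y)

PositiveSummand : List ℕ → ℕ → Set
PositiveSummand A n = ∃[ x ] ∃[ m ] (x ∈ A × 0 < x × n ≡ x + m × IsComb A m)

PositiveSummand-∷ : ∀ {x A m} → PositiveSummand A m → PositiveSummand (x ∷ A) m
PositiveSummand-∷ (y , m , y∈ , y>0 , eq , c) = y , m , there y∈ , y>0 , eq , 0 , m , refl , c

IsComb⇒PositiveSummand : ∀ A {n} → IsComb A n → 0 < n → PositiveSummand A n
IsComb⇒PositiveSummand []      refl ()
IsComb⇒PositiveSummand (x ∷ A) (zero , m , refl , c) n>0 =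
  PositiveSummand-∷ (IsComb⇒PositiveSummand A c n>0)
IsComb⇒PositiveSummand (zero ∷ A) (suc k , m , refl , c) n>0 with k * 0 | *-zeroʳ k
... | _ | refl = PositiveSummand-∷ (IsComb⇒PositiveSummand A c n>0)
IsComb⇒PositiveSummand (suc x ∷ A) (suc k , m , refl , c) _ =
  suc x , k * suc x + m , here refl , s≤s z≤n , +-assoc (suc x) (k * suc x) m , k , m , refl , c

*-closed : ∀ S {x} → x ∈S S → ∀ k → (k * x) ∈S S
*-closed S x∈ zero    = zero∈ S
*-closed S x∈ (suc k) = closed S _ _ x∈ (*-closed S x∈ k)

IsComb⇒∈S : ∀ S {A} → (∀ {x} → x ∈ A → x ∈S S) → ∀ {n} → IsComb A n → n ∈S S
IsComb⇒∈S S {[]}    _   refl                 = zero∈ S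
IsComb⇒∈S S {x ∷ A} A⊆S (k , m , refl , c) =
  closed S _ _ (*-closed S (A⊆S (here refl)) k) (IsComb⇒∈S S (A⊆S ∘ there) c)

∈S⊎∉S : ∀ S x → x ∈S S ⊎ x ∉S S
∈S⊎∉S S x with mem S x
... | true  = inj₁ refl
... | false = inj₂ refl

∈S⇒¬∉S : ∀ {S x} → x ∈S S → ¬ x ∉S S
∈S⇒¬∉S x∈ x∉ with () ← trans (sym x∈) x∉

Decomposable : NumericalSemigroup → ℕ → Set
Decomposable S x = ∃[ y ] ∃[ z ] (0 < y × 0 < z × y + z ≡ x × y ∈S S × z ∈S S)

IsAtom : NumericalSemigroup → ℕ → Set
IsAtom S x = x ∈S S × 0 < x × ¬ Decomposable S x

PositiveSummand⇒atom-∈ : ∀ {S A x} → (∀ {y} → y ∈ A → y ∈S S) → IsAtom S x →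
                         PositiveSummand A x → x ∈ A
PositiveSummand⇒atom-∈ A⊆S (_ , _ , ¬dec) (y , zero , y∈ , _ , refl , _) =
  subst (_∈ _) (sym (+-identityʳ y)) y∈
PositiveSummand⇒atom-∈ {S} A⊆S (_ , _ , ¬dec) (y , suc m , y∈ , y>0 , refl , c) =
  ⊥-elim (¬dec (y , suc m , y>0 , s≤s z≤n , refl , A⊆S y∈ , IsComb⇒∈S S A⊆S c))

module MinimalGeneratingSet {S A} (minimal : IsMinimalGeneratingSet S A) where

  private
    generates : ∀ n → n ∈S S ⇔ IsComb A n
    generates = proj₁ (proj₂ minimal)
    nonredundant : ∀ i → ¬ IsComb (removeAt A i) (lookup A i)
    nonredundant = proj₂ (proj₂ minimal)

  ∈⇒∈S : ∀ {x} → x ∈ A → x ∈S S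
  ∈⇒∈S p = Equivalence.from (generates _) (∈⇒IsComb p)

  lookup-atom : ∀ i → IsAtom S (lookup A i)
  lookup-atom i = ∈⇒∈S (∈-lookup i) , positive , indecomposable
    where
    positive : 0 < lookup A i
    positive with lookup A i in eq
    ... | zero  = ⊥-elim (nonredundant i (subst (IsComb _) (sym eq) (IsComb-0 _)))
    ... | suc _ = s≤s z≤n
    restricted : ∀ {y z} → 0 < z → y + z ≡ lookup A i → y ∈S S → IsComb (removeAt A i) y
    restricted {y} z>0 y+z≡x y∈ =
      IsComb-removeAt A i (Equivalence.to (generates y) y∈) (subst (y <_) y+z≡x (m<m+n y z>0))
    indecomposable : ¬ Decomposable S (lookup A i)
    indecomposable (y , z , y>0 , z>0 , y+z≡x , y∈ , z∈) =
      nonredundant i (subst (IsComb _) y+z≡x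
        (IsComb-+ _ (restricted z>0 y+z≡x y∈) (restricted y>0 (trans (+-comm z y) y+z≡x) z∈)))

  ∈⇒atom : ∀ {x} → x ∈ A → IsAtom S x
  ∈⇒atom p = subst (IsAtom S) (sym (lookup-index p)) (lookup-atom (index p))

  atom⇒∈ : ∀ {x} → IsAtom S x → x ∈ A
  atom⇒∈ {x} atom@(x∈ , x>0 , _) = PositiveSummand⇒atom-∈ {S} ∈⇒∈S atom
    (IsComb⇒PositiveSummand A (Equivalence.to (generates x) x∈) x>0)

module AtomList {S L} (unique : Unique L) (atoms : ∀ {x} → x ∈ L → IsAtom S x)
  (∈⊎decomposable : ∀ {x} → x ∈S S → 0 < x → x ∈ L ⊎ Decomposable S x) where

  private
    L⊆S : ∀ {x} → x ∈ L → x ∈S S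
    L⊆S = proj₁ ∘ atoms

  ∈S⇒IsComb : ∀ n → n ∈S S → IsComb L n
  ∈S⇒IsComb = <-rec _ step
    where
    step : ∀ n → (∀ {m} → m < n → m ∈S S → IsComb L m) → n ∈S S → IsComb L n
    step zero    _   _  = IsComb-0 L
    step (suc n) rec n∈ with ∈⊎decomposable n∈ (s≤s z≤n)
    ... | inj₁ n∈L = ∈⇒IsComb n∈L
    ... | inj₂ (y , z , y>0 , z>0 , y+z≡n , y∈ , z∈) = subst (IsComb L) y+z≡n
      (IsComb-+ L (rec (subst (y <_) y+z≡n (m<m+n y z>0)) y∈)
                  (rec (subst (z <_) (trans (+-comm z y) y+z≡n) (m<m+n z y>0)) z∈))

  nonredundant : ∀ i → ¬ IsComb (removeAt L i) (lookup L i)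
  nonredundant i c with atoms (∈-lookup i)
  ... | atom@(_ , x>0 , _) =
    lookup∉removeAt unique i
      (PositiveSummand⇒atom-∈ {S} (L⊆S ∘ ∈-removeAt⁻ L i) atom
        (IsComb⇒PositiveSummand (removeAt L i) c x>0))

  minimalGeneratingSet : IsMinimalGeneratingSet S L
  minimalGeneratingSet =
    unique , (λ n → mk⇔ (∈S⇒IsComb n) (IsComb⇒∈S S L⊆S)) , nonredundant

  length-minimalGeneratingSet : ∀ {A} → IsMinimalGeneratingSet S A → length A ≡ length L
  length-minimalGeneratingSet {A} minimal =
    ↭-length (∼bag⇒↭ (unique∧set⇒bag (proj₁ minimal) unique (mk⇔ A⊆L L⊆A)))
    where
    open MinimalGeneratingSet {S} {A} minimal
    A⊆L : ∀ {x} → x ∈ A → x ∈ L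
    A⊆L p with ∈⇒atom p
    ... | x∈ , x>0 , ¬dec with ∈⊎decomposable x∈ x>0
    ...   | inj₁ x∈L = x∈L
    ...   | inj₂ dec = ⊥-elim (¬dec dec)
    L⊆A : ∀ {x} → x ∈ L → x ∈ A
    L⊆A = atom⇒∈ ∘ atoms

gapsIn : NumericalSemigroup → ℕ → ℕ → ℕ
gapsIn S b zero    = 0
gapsIn S b (suc k) with mem S (k + b)
... | true  = gapsIn S b k
... | false = suc (gapsIn S b k)

gapsBelow-+ : ∀ S b k → gapsBelow S (k + b) ≡ gapsIn S b k + gapsBelow S b
gapsBelow-+ S b zero = refl
gapsBelow-+ S b (suc k) with mem S (k + b)
... | true  = gapsBelow-+ S b k
... | false = cong suc (gapsBelow-+ S b k)

gapsBelow-mono : ∀ S {m n} → m ≤ n → gapsBelow S m ≤ gapsBelow S n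
gapsBelow-mono S {m} {n} m≤n = begin
  gapsBelow S m                               ≤⟨ m≤n+m _ _ ⟩
  gapsIn S m (n ∸ m) + gapsBelow S m          ≡⟨ gapsBelow-+ S m (n ∸ m) ⟨
  gapsBelow S (n ∸ m + m)                     ≡⟨ cong (gapsBelow S) (m∸n+n≡m m≤n) ⟩
  gapsBelow S n                               ∎
  where open ≤-Reasoning

gapsIn-bound : ∀ S k → gapsIn S (bound S) k ≡ 0
gapsIn-bound S zero = refl
gapsIn-bound S (suc k) with mem S (k + bound S) in eq
... | true  = gapsIn-bound S k
... | false = ⊥-elim (∈S⇒¬∉S {S} (cofinite S _ (m≤n+m _ k)) eq)

gapsBelow≤genus : ∀ S n → gapsBelow S n ≤ genus S
gapsBelow≤genus S n = begin
  gapsBelow S n                                  ≤⟨ gapsBelow-mono S (m≤m+n n (bound S)) ⟩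
  gapsBelow S (n + bound S)                      ≡⟨ gapsBelow-+ S (bound S) n ⟩
  gapsIn S (bound S) n + genus S                 ≡⟨ cong (_+ genus S) (gapsIn-bound S n) ⟩
  genus S                                        ∎
  where open ≤-Reasoning

gapsBelow≡genus⇒∈S : ∀ S {m n} → gapsBelow S m ≡ genus S → m ≤ n → n ∈S S
gapsBelow≡genus⇒∈S S {m} {n} all-gaps m≤n with mem S n in eq
... | true  = refl
... | false = ⊥-elim (<-irrefl refl (begin-strict
  genus S                   ≡⟨ all-gaps ⟨
  gapsBelow S m             ≤⟨ gapsBelow-mono S m≤n ⟩
  gapsBelow S n             <⟨ n<1+n _ ⟩
  suc (gapsBelow S n)       ≡⟨ gap-step ⟨
  gapsBelow S (suc n)       ≤⟨ gapsBelow≤genus S (suc n) ⟩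
  genus S                   ∎))
  where
  open ≤-Reasoning
  gap-step : gapsBelow S (suc n) ≡ suc (gapsBelow S n)
  gap-step rewrite eq = refl

residue-unique-≤ : ∀ {a n s t} → s ≤ t → t < a → a ∣ n + s → a ∣ n + t → s ≡ t
residue-unique-≤ {a} {n} {s} s≤t t<a a∣n+s a∣n+t with m≤n⇒∃[o]m+o≡n s≤t
... | zero  , refl = sym (+-identityʳ s)
... | suc d , refl = ⊥-elim (>⇒∤ (≤-<-trans (m≤n+m (suc d) s) t<a) a∣d)
  where
  a∣d : a ∣ suc d
  a∣d = ∣m+n∣m⇒∣n (subst (a ∣_) (sym (+-assoc n s (suc d))) a∣n+t) a∣n+s

residue-unique : ∀ {a n s t} → s < a → t < a → a ∣ n + s → a ∣ n + t → s ≡ t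
residue-unique {s = s} {t} s<a t<a a∣n+s a∣n+t with ≤-total s t
... | inj₁ s≤t = residue-unique-≤ s≤t t<a a∣n+s a∣n+t
... | inj₂ t≤s = sym (residue-unique-≤ t≤s s<a a∣n+t a∣n+s)

complement-residue : ∀ {a} n .{{_ : NonZero a}} → ¬ a ∣ n → ∃[ s ] (0 < s × s < a × a ∣ n + s)
complement-residue {a} n a∤n with n % a in eq
... | zero  = ⊥-elim (a∤n (m%n≡0⇒n∣m n a eq))
... | suc r = a ∸ suc r , m<n⇒0<n∸m r<a , ∸-monoʳ-< z<s (<⇒≤ r<a) , divides (suc (n / a)) n+s≡
  where
  r<a : suc r < a
  r<a = subst (_< a) eq (m%n<n n a)
  n+s≡ : n + (a ∸ suc r) ≡ suc (n / a) * a
  n+s≡ = begin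
    n + (a ∸ suc r)                    ≡⟨ cong (_+ (a ∸ suc r)) (m≡m%n+[m/n]*n n a) ⟩
    n % a + n / a * a + (a ∸ suc r)    ≡⟨ cong (λ r′ → r′ + n / a * a + (a ∸ suc r)) eq ⟩
    suc r + n / a * a + (a ∸ suc r)    ≡⟨ +-assoc (suc r) _ _ ⟩
    suc r + (n / a * a + (a ∸ suc r))  ≡⟨ cong (suc r +_) (+-comm (n / a * a) _) ⟩
    suc r + ((a ∸ suc r) + n / a * a)  ≡⟨ +-assoc (suc r) _ _ ⟨
    suc r + (a ∸ suc r) + n / a * a    ≡⟨ cong (_+ n / a * a) (m+[n∸m]≡n (<⇒≤ r<a)) ⟩
    a + n / a * a                      ∎
    where open ≡-Reasoning

module Reflective (S : NumericalSemigroup) (reflective : IsReflective S) where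

  g : ℕ
  g = genus S

  ∈S⇒g+∉S : ∀ {z} → z < g → z ∈S S → (g + z) ∉S S
  ∈S⇒g+∉S {z} z<g z∈ with reflective z z<g
  ... | inj₁ (_ , z+g∉) = subst (_∉S S) (+-comm z g) z+g∉
  ... | inj₂ (z∉ , _)   = ⊥-elim (∈S⇒¬∉S {S} z∈ z∉)

  ∉S⇒g+∈S : ∀ {z} → z < g → z ∉S S → (g + z) ∈S S
  ∉S⇒g+∈S {z} z<g z∉ with reflective z z<g
  ... | inj₁ (z∈ , _)   = ⊥-elim (∈S⇒¬∉S {S} z∈ z∉)
  ... | inj₂ (_ , z+g∈) = subst (_∈S S) (+-comm z g) z+g∈

  g+∉S⇒∈S : ∀ {z} → z < g → (g + z) ∉S S → z ∈S S
  g+∉S⇒∈S {z} z<g g+z∉ with ∈S⊎∉S S z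
  ... | inj₁ z∈ = z∈
  ... | inj₂ z∉ = ⊥-elim (∈S⇒¬∉S {S} (∉S⇒g+∈S z<g z∉) g+z∉)

  gapsBelow+gapsIn-g : ∀ k → k ≤ g → gapsBelow S k + gapsIn S g k ≡ k
  gapsBelow+gapsIn-g zero    _   = refl
  gapsBelow+gapsIn-g (suc k) k<g with mem S k | mem S (k + g) | reflective k k<g
  ... | true  | false | _ = trans (+-suc _ _) (cong suc (gapsBelow+gapsIn-g k (<⇒≤ k<g)))
  ... | false | true  | _ = cong suc (gapsBelow+gapsIn-g k (<⇒≤ k<g))
  ... | true  | true  | inj₁ (_ , ())
  ... | true  | true  | inj₂ (() , _)
  ... | false | false | inj₁ (() , _)
  ... | false | false | inj₂ (_ , ())

  gapsBelow-2g : gapsBelow S (g + g) ≡ g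
  gapsBelow-2g = begin
    gapsBelow S (g + g)              ≡⟨ gapsBelow-+ S g g ⟩
    gapsIn S g g + gapsBelow S g     ≡⟨ +-comm (gapsIn S g g) _ ⟩
    gapsBelow S g + gapsIn S g g     ≡⟨ gapsBelow+gapsIn-g g ≤-refl ⟩
    g                                ∎
    where open ≡-Reasoning

  2g≤⇒∈S : ∀ {n} → g + g ≤ n → n ∈S S
  2g≤⇒∈S = gapsBelow≡genus⇒∈S S gapsBelow-2g

module ReflectiveWithMultiplicity (S : NumericalSemigroup) (reflective : IsReflective S)
  (g≥1 : 1 ≤ genus S) {a} (multiplicity : IsMultiplicity S a) where

  open Reflective S reflective public

  a>0 : 0 < a
  a>0 = proj₁ multiplicity

  a∈S : a ∈S S
  a∈S = proj₁ (proj₂ multiplicity)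

  ∉S-below-a : ∀ {b} → 0 < b → b < a → b ∉S S
  ∉S-below-a = proj₂ (proj₂ multiplicity) _

  instance
    a-nonZero : NonZero a
    a-nonZero = >-nonZero a>0

  <a∧∈S⇒≡0 : ∀ {x} → x < a → x ∈S S → x ≡ 0
  <a∧∈S⇒≡0 {zero}  _   _  = refl
  <a∧∈S⇒≡0 {suc x} x<a x∈ = ⊥-elim (∈S⇒¬∉S {S} x∈ (∉S-below-a z<s x<a))

  g∉S : g ∉S S
  g∉S = subst (_∉S S) (+-identityʳ g) (∈S⇒g+∉S g≥1 (zero∈ S))

  g≤∧∈S⇒g< : ∀ {y} → g ≤ y → y ∈S S → g < y
  g≤∧∈S⇒g< g≤y y∈ = ≤∧≢⇒< g≤y λ g≡y → ∈S⇒¬∉S {S} (subst (_∈S S) (sym g≡y) y∈) g∉S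

  a∣⇒∈S : ∀ {n} → a ∣ n → n ∈S S
  a∣⇒∈S (divides q refl) = *-closed S a∈S q

  a∤g : ¬ a ∣ g
  a∤g a∣g = ∈S⇒¬∉S {S} (a∣⇒∈S a∣g) g∉S

  ∈S-below-g⇒a∣ : ∀ {x} → x < g → x ∈S S → a ∣ x
  ∈S-below-g⇒a∣ {x} = <-rec (λ x → x < g → x ∈S S → a ∣ x) step x
    where
    step : ∀ x → (∀ {y} → y < x → y < g → y ∈S S → a ∣ y) → x < g → x ∈S S → a ∣ x
    step x rec x<g x∈ with x <? a
    ... | yes x<a = subst (a ∣_) (sym (<a∧∈S⇒≡0 x<a x∈)) (a ∣0)
    ... | no  x≮a with m≤n⇒∃[o]m+o≡n (≮⇒≥ x≮a)
    ... | y , refl = ∣m∣n⇒∣m+n ∣-refl (rec (m<n+m y a>0) y<g y∈)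
      where
      y<g : y < g
      y<g = ≤-<-trans (m≤n+m y a) x<g
      y∈ : y ∈S S
      y∈ with ∈S⊎∉S S y
      ... | inj₁ y∈ = y∈
      ... | inj₂ y∉ = ⊥-elim (∈S⇒¬∉S {S}
        (subst (_∈S S) (x∙yz≈y∙xz a g y) (closed S a (g + y) a∈S (∉S⇒g+∈S y<g y∉)))
        (∈S⇒g+∉S x<g x∈))

  ∈S-below-g⇒a+∈S : ∀ {y} → y < g → 0 < y → y ∈S S → ∃[ w ] (y ≡ a + w × w ∈S S)
  ∈S-below-g⇒a+∈S {y} y<g y>0 y∈ =
    let w , a+w≡y = m≤n⇒∃[o]m+o≡n (∣⇒≤ ⦃ >-nonZero y>0 ⦄ a∣y)
    in  w , sym a+w≡y , a∣⇒∈S (∣m+n∣m⇒∣n (subst (a ∣_) (sym a+w≡y) a∣y) ∣-refl)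
    where
    a∣y : a ∣ y
    a∣y = ∈S-below-g⇒a∣ y<g y∈

  a≥2 : 2 ≤ a
  a≥2 = ≤∧≢⇒< a>0 λ 1≡a →
    ∈S⇒¬∉S {S} (subst (λ b → (g * b) ∈S S) (sym 1≡a) (*-closed S a∈S g))
      (subst (_∉S S) (sym (*-identityʳ g)) g∉S)

  g+∈S : ∀ {t} → 0 < t → t < a → (g + t) ∈S S
  g+∈S {t} t>0 t<a with t <? g
  ... | yes t<g = ∉S⇒g+∈S t<g (∉S-below-a t>0 t<a)
  ... | no  t≮g = 2g≤⇒∈S (+-monoʳ-≤ g (≮⇒≥ t≮g))

  a≤1+g : a ≤ suc g
  a≤1+g with suc g <? a
  ... | no  1+g≮a = ≮⇒≥ 1+g≮a
  ... | yes 1+g<a = ⊥-elim (∈S⇒¬∉S {S}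
    (subst (_∈S S) (+-comm g 1) (g+∈S z<s a≥2)) (∉S-below-a z<s 1+g<a))

module Generators (S : NumericalSemigroup) (reflective : IsReflective S) (g≥1 : 1 ≤ genus S)
  {a} (multiplicity : IsMultiplicity S a)
  {s} (s>0 : 0 < s) (s<a : s < a) (a∣g+s : a ∣ genus S + s) where

  open ReflectiveWithMultiplicity S reflective g≥1 multiplicity

  a∣g+⇒≡s : ∀ {t} → t < a → a ∣ g + t → t ≡ s
  a∣g+⇒≡s t<a a∣g+t = residue-unique t<a s<a a∣g+t a∣g+s

  g+a≤2g+1 : g + a ≤ suc (g + g)
  g+a≤2g+1 = subst (g + a ≤_) (+-suc g g) (+-monoʳ-≤ g a≤1+g)

  data Generator : ℕ → Set where
    gen-a     : Generator a
    gen-g+    : ∀ {t} → 0 < t → t < a → t ≢ s → Generator (g + t)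
    gen-2g+1  : s ≡ 1 → Generator (suc (g + g))

  generator-between : ∀ {x} → g < x → x < g + a → x ≢ g + s → Generator x
  generator-between g<x x<g+a x≢g+s with m≤n⇒∃[o]m+o≡n g<x
  ... | e , refl = subst Generator (+-suc g e)
    (gen-g+ z<s (+-cancelˡ-< g _ a (subst (_< g + a) (sym (+-suc g e)) x<g+a))
               λ 1+e≡s → x≢g+s (trans (sym (+-suc g e)) (cong (g +_) 1+e≡s)))

  decomposable⇒a+∈S : ∀ {x} → x ≤ suc (g + g) → Decomposable S x → ∃[ w ] (x ≡ a + w × w ∈S S)
  decomposable⇒a+∈S x≤ (y , z , y>0 , z>0 , refl , y∈ , z∈) with y <? g | z <? g
  ... | yes y<g | _ =
    let w , y≡a+w , w∈ = ∈S-below-g⇒a+∈S y<g y>0 y∈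
    in  w + z , trans (cong (_+ z) y≡a+w) (+-assoc a w z) , closed S w z w∈ z∈
  ... | no _ | yes z<g =
    let w , z≡a+w , w∈ = ∈S-below-g⇒a+∈S z<g z>0 z∈
    in  y + w , trans (cong (y +_) z≡a+w) (x∙yz≈y∙xz y a w) , closed S y w y∈ w∈
  ... | no y≮g | no z≮g = ⊥-elim (<⇒≱ 2g+1<y+z x≤)
    where
    2g+1<y+z : suc (g + g) < y + z
    2g+1<y+z = subst (_≤ y + z) (cong suc (+-suc g g))
      (+-mono-≤ (g≤∧∈S⇒g< (≮⇒≥ y≮g) y∈) (g≤∧∈S⇒g< (≮⇒≥ z≮g) z∈))

  a+∈S≡g+⇒≡s : ∀ {w t} → t < a → a + w ≡ g + t → w ∈S S → t ≡ s
  a+∈S≡g+⇒≡s {w} {t} t<a a+w≡g+t w∈ = a∣g+⇒≡s t<a (subst (a ∣_) a+w≡g+t a∣a+w)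
    where
    w<g : w < g
    w<g = +-cancelˡ-< a w g (subst (_< a + g) (sym a+w≡g+t)
      (subst (g + t <_) (+-comm g a) (+-monoʳ-< g t<a)))
    a∣a+w : a ∣ a + w
    a∣a+w = ∣m∣n⇒∣m+n ∣-refl (∈S-below-g⇒a∣ w<g w∈)

  a+∈S≢2g+1 : ∀ {w} → s ≡ 1 → w ∈S S → a + w ≢ suc (g + g)
  a+∈S≢2g+1 {w} s≡1 w∈ a+w≡2g+1 =
    ∈S⇒¬∉S {S} (subst (_∈S S) w≡g+u w∈) (∈S⇒g+∉S u<g (a∣⇒∈S a∣u))
    where
    open ≡-Reasoning
    u : ℕ
    u = suc g ∸ a
    a+u≡1+g : a + u ≡ suc g
    a+u≡1+g = m+[n∸m]≡n a≤1+g
    u<g : u < g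
    u<g = +-cancelˡ-< a u g (subst (_< a + g) (sym a+u≡1+g) (+-monoˡ-< g a≥2))
    a∣u : a ∣ u
    a∣u = ∣m+n∣m⇒∣n (subst (a ∣_) g+s≡a+u a∣g+s) ∣-refl
      where
      g+s≡a+u : g + s ≡ a + u
      g+s≡a+u = trans (cong (g +_) s≡1) (trans (+-comm g 1) (sym a+u≡1+g))
    w≡g+u : w ≡ g + u
    w≡g+u = +-cancelˡ-≡ a w (g + u) (begin
      a + w         ≡⟨ a+w≡2g+1 ⟩
      suc (g + g)   ≡⟨ +-suc g g ⟨
      g + suc g     ≡⟨ cong (g +_) a+u≡1+g ⟨
      g + (a + u)   ≡⟨ x∙yz≈y∙xz g a u ⟩
      a + (g + u)   ∎)

  generator⇒atom : ∀ {x} → Generator x → IsAtom S x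
  generator⇒atom gen-a = a∈S , a>0 , λ (y , z , y>0 , z>0 , y+z≡a , y∈ , _) →
    <⇒≢ y>0 (sym (<a∧∈S⇒≡0 (subst (y <_) y+z≡a (m<m+n y z>0)) y∈))
  generator⇒atom (gen-g+ {t} t>0 t<a t≢s) = g+∈S t>0 t<a , ≤-trans t>0 (m≤n+m t g) , λ dec →
    let w , g+t≡a+w , w∈ = decomposable⇒a+∈S (≤-trans (<⇒≤ (+-monoʳ-< g t<a)) g+a≤2g+1) dec
    in  t≢s (a+∈S≡g+⇒≡s t<a (sym g+t≡a+w) w∈)
  generator⇒atom (gen-2g+1 s≡1) = 2g≤⇒∈S (n≤1+n _) , z<s , λ dec →
    let w , 2g+1≡a+w , w∈ = decomposable⇒a+∈S ≤-refl dec
    in  a+∈S≢2g+1 s≡1 w∈ (sym 2g+1≡a+w)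

  g+multiple : ∀ {v} → a ∣ v → v < a + g → (g + v) ∈S S → Generator (g + v) ⊎ Decomposable S (g + v)
  g+multiple {v} a∣v v<a+g g+v∈ with <-cmp v g
  ... | tri< v<g _ _ = ⊥-elim (∈S⇒¬∉S {S} g+v∈ (∈S⇒g+∉S v<g (a∣⇒∈S a∣v)))
  ... | tri≈ _ v≡g _ = ⊥-elim (a∤g (subst (a ∣_) v≡g a∣v))
  ... | tri> _ _ g<v with m≤n⇒∃[o]m+o≡n g<v
  ...   | zero , refl = inj₁ (subst Generator 2g+1≡ (gen-2g+1 (sym 1≡s)))
    where
    1≡s : 1 ≡ s
    1≡s = a∣g+⇒≡s a≥2 (subst (a ∣_) (trans (+-identityʳ (suc g)) (+-comm 1 g)) a∣v)
    2g+1≡ : suc (g + g) ≡ g + (suc g + 0)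
    2g+1≡ = solve 1 (λ g → con 1 :+ (g :+ g) := g :+ (con 1 :+ g :+ con 0)) refl g
  ...   | suc e , refl = inj₂ (g + 1 , g + suc e , m≤n+m 1 g , ≤-trans z<s (m≤n+m (suc e) g) ,
                            sum≡ , g+∈S z<s a≥2 , g+∈S z<s 1+e<a)
    where
    sum≡ : g + 1 + (g + suc e) ≡ g + (suc g + suc e)
    sum≡ = solve 2 (λ g e → g :+ con 1 :+ (g :+ (con 1 :+ e)) := g :+ ((con 1 :+ g) :+ (con 1 :+ e)))
                   refl g e
    1+e<a : suc e < a
    1+e<a = +-cancelˡ-< g (suc e) a
      (<-trans (n<1+n _) (subst (suc g + suc e <_) (+-comm a g) v<a+g))

  a+gap-below-g : ∀ {w} → w < g → w ∉S S → (a + w) ∈S S → Generator (a + w)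
  a+gap-below-g {w} w<g w∉ x∈ with a + w <? g
  ... | yes x<g = ⊥-elim (∈S⇒¬∉S {S} (a∣⇒∈S a∣w) w∉)
    where
    a∣w : a ∣ w
    a∣w = ∣m+n∣m⇒∣n (∈S-below-g⇒a∣ x<g x∈) ∣-refl
  ... | no  x≮g = generator-between (g≤∧∈S⇒g< (≮⇒≥ x≮g) x∈)
    (subst (a + w <_) (+-comm a g) (+-monoʳ-< a w<g))
    λ x≡g+s → ∈S⇒¬∉S {S} (a∣⇒∈S (∣m+n∣m⇒∣n (subst (a ∣_) (sym x≡g+s) a∣g+s) ∣-refl)) w∉

  a+gap : ∀ {w} → w ∉S S → (a + w) ∈S S → Generator (a + w) ⊎ Decomposable S (a + w)
  a+gap {w} w∉ x∈ with w <? g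
  ... | yes w<g = inj₁ (a+gap-below-g w<g w∉ x∈)
  ... | no  w≮g with m≤n⇒∃[o]m+o≡n (≮⇒≥ w≮g)
  ...   | u , refl with u <? g
  ...     | no  u≮g = ⊥-elim (∈S⇒¬∉S {S} (2g≤⇒∈S (+-monoʳ-≤ g (≮⇒≥ u≮g))) w∉)
  ...     | yes u<g = subst (λ x → Generator x ⊎ Decomposable S x) (sym (x∙yz≈y∙xz a g u))
    (g+multiple (∣m∣n⇒∣m+n ∣-refl (∈S-below-g⇒a∣ u<g (g+∉S⇒∈S u<g w∉))) (+-monoʳ-< a u<g)
      (subst (_∈S S) (x∙yz≈y∙xz a g u) x∈))

  ∈S⇒generator⊎decomposable : ∀ {x} → x ∈S S → 0 < x → Generator x ⊎ Decomposable S x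
  ∈S⇒generator⊎decomposable {x} x∈ x>0 with x <? a
  ... | yes x<a = ⊥-elim (<⇒≢ x>0 (sym (<a∧∈S⇒≡0 x<a x∈)))
  ... | no  x≮a with m≤n⇒∃[o]m+o≡n (≮⇒≥ x≮a)
  ...   | zero , refl = inj₁ (subst Generator (sym (+-identityʳ a)) gen-a)
  ...   | suc w , refl with ∈S⊎∉S S (suc w)
  ...     | inj₁ w∈ = inj₂ (a , suc w , a>0 , z<s , refl , a∈S , w∈)
  ...     | inj₂ w∉ = a+gap w∉ x∈

  extra : ℕ → List ℕ
  extra 1 = [ suc (g + g) ]
  extra _ = []

  ∈-extra⁻ : ∀ {t x} → x ∈ extra t → t ≡ 1 × x ≡ suc (g + g)
  ∈-extra⁻ {1} (here refl) = refl , refl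

  length-extra : ∀ {t} → t ≢ 1 → length (extra t) ≡ 0
  length-extra {0}           _   = refl
  length-extra {1}           t≢1 = ⊥-elim (t≢1 refl)
  length-extra {suc (suc _)} _   = refl

  g<g+s : g < g + s
  g<g+s = m<m+n g s>0

  g+s<g+a : g + s < g + a
  g+s<g+a = +-monoʳ-< g s<a

  middle : List ℕ
  middle = punctured (suc g) (g + s) (g + a)

  generators : List ℕ
  generators = a ∷ middle ++ extra s

  ∈generators⁻ : ∀ {x} → x ∈ generators → Generator x
  ∈generators⁻ (here refl) = gen-a
  ∈generators⁻ (there p) with ∈-++⁻ middle p
  ... | inj₁ q = let g<x , x<g+a , x≢g+s = ∈-punctured⁻ g<g+s g+s<g+a q
                 in  generator-between g<x x<g+a x≢g+s
  ... | inj₂ q with ∈-extra⁻ {s} q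
  ...   | s≡1 , refl = gen-2g+1 s≡1

  ∈generators⁺ : ∀ {x} → Generator x → x ∈ generators
  ∈generators⁺ gen-a = here refl
  ∈generators⁺ (gen-g+ t>0 t<a t≢s) = there (∈-++⁺ˡ (∈-punctured⁺ g<g+s g+s<g+a
    (m<m+n g t>0) (+-monoʳ-< g t<a) (t≢s ∘ +-cancelˡ-≡ g _ _)))
  ∈generators⁺ (gen-2g+1 s≡1) =
    there (∈-++⁺ʳ middle (subst (λ t → suc (g + g) ∈ extra t) (sym s≡1) (here refl)))

  a<g+ : ∀ {x} → g < x → x ≢ g + s → a < x
  a<g+ {x} g<x x≢g+s = ≤∧≢⇒< (≤-trans a≤1+g g<x) λ a≡x →
    let a≡1+g = ≤-antisym a≤1+g (subst (suc g ≤_) (sym a≡x) g<x)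
        1≡s   = a∣g+⇒≡s a≥2 (subst (a ∣_) (trans a≡1+g (+-comm 1 g)) ∣-refl)
    in  x≢g+s (trans (sym a≡x) (trans a≡1+g (trans (+-comm 1 g) (cong (g +_) 1≡s))))

  generators-sorted : AllPairs _<_ generators
  generators-sorted = All.tabulate a<tail ∷
    ++-sorted (punctured-sorted g<g+s g+s<g+a) (extra-sorted s) middle<g+a g+a≤extra
    where
    a<tail : ∀ {x} → x ∈ middle ++ extra s → a < x
    a<tail p with ∈-++⁻ middle p
    ... | inj₁ q = let g<x , _ , x≢g+s = ∈-punctured⁻ g<g+s g+s<g+a q in a<g+ g<x x≢g+s
    ... | inj₂ q with ∈-extra⁻ {s} q
    ...   | _ , refl = ≤-<-trans a≤1+g (s≤s (m<m+n g g≥1))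
    extra-sorted : ∀ t → AllPairs _<_ (extra t)
    extra-sorted 1 = All.[] ∷ []
    extra-sorted 0 = []
    extra-sorted (suc (suc _)) = []
    middle<g+a : ∀ {x} → x ∈ middle → x < g + a
    middle<g+a q = proj₁ (proj₂ (∈-punctured⁻ g<g+s g+s<g+a q))
    g+a≤extra : ∀ {x} → x ∈ extra s → g + a ≤ x
    g+a≤extra q with ∈-extra⁻ {s} q
    ... | _ , refl = g+a≤2g+1

  generators-unique : Unique generators
  generators-unique = AllPairs.map <⇒≢ generators-sorted

  length-generators : length generators ≡ a ∸ 1 + length (extra s)
  length-generators = begin
    suc (length (middle ++ extra s))   ≡⟨ cong suc (length-++ middle) ⟩
    suc (length middle) + ε            ≡⟨ cong (_+ ε) (length-punctured g<g+s g+s<g+a) ⟩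
    (g + a) ∸ suc g + ε                ≡⟨ cong (λ k → (g + a) ∸ k + ε) (+-comm 1 g) ⟩
    (g + a) ∸ (g + 1) + ε              ≡⟨ cong (_+ ε) ([m+n]∸[m+o]≡n∸o g a 1) ⟩
    a ∸ 1 + ε                          ∎
    where
    open ≡-Reasoning
    ε : ℕ
    ε = length (extra s)

  length-generators-a∤1+g : ¬ a ∣ suc g → length generators ≡ a ∸ 1
  length-generators-a∤1+g a∤1+g =
    trans length-generators (trans (cong (a ∸ 1 +_) (length-extra s≢1)) (+-identityʳ (a ∸ 1)))
    where
    s≢1 : s ≢ 1
    s≢1 s≡1 = a∤1+g (subst (a ∣_) (trans (cong (g +_) s≡1) (+-comm g 1)) a∣g+s)

  length-generators-a∣1+g : a ∣ suc g → length generators ≡ a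
  length-generators-a∣1+g a∣1+g =
    trans length-generators (trans (cong (λ t → a ∸ 1 + length (extra t)) s≡1) (m∸n+n≡m a>0))
    where
    s≡1 : s ≡ 1
    s≡1 = sym (a∣g+⇒≡s a≥2 (subst (a ∣_) (+-comm 1 g) a∣1+g))

  open AtomList {S} {generators} generators-unique (generator⇒atom ∘ ∈generators⁻)
    (λ x∈ x>0 → Sum.map₁ ∈generators⁺ (∈S⇒generator⊎decomposable x∈ x>0)) public
    using (minimalGeneratingSet; length-minimalGeneratingSet)

corollary3p8 : (S : NumericalSemigroup) (g a : ℕ) →
    genus S ≡ g → 1 ≤ g → IsReflective S → IsMultiplicity S a →
    (∃[ A ] IsMinimalGeneratingSet S A) ×
    (∀ A → IsMinimalGeneratingSet S A →
      (¬ (a ∣ suc g) → length A ≡ a ∸ 1) × (a ∣ suc g → length A ≡ a))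
corollary3p8 S g a refl g≥1 reflective multiplicity =
  (generators , minimalGeneratingSet) , λ A minimal →
    (λ a∤1+g → trans (length-minimalGeneratingSet minimal) (length-generators-a∤1+g a∤1+g)) ,
    (λ a∣1+g → trans (length-minimalGeneratingSet minimal) (length-generators-a∣1+g a∣1+g))
  where
  open ReflectiveWithMultiplicity S reflective g≥1 multiplicity using (a∤g; a-nonZero)
  residue : ∃[ s ] (0 < s × s < a × a ∣ g + s)
  residue = complement-residue g a∤g
  open Generators S reflective g≥1 multiplicity
    (proj₁ (proj₂ residue)) (proj₁ (proj₂ (proj₂ residue))) (proj₂ (proj₂ (proj₂ residue)))
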